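{- Let $M=(\Sigma,A_{S_0},T_R)$ be a locally-finite regular system, $LEP=\{\ell ep_1,\dots,\ell ep_k\}$ a set of local execution properties, $\ell osp$ a local-oriented system property over $LEP$, and $M^a_{\neg\ell osp}=(\Sigma^a,A^a_{S_0},T^a_R,F^a)$ the Büchi regular system constructed from them as in the context, with relation $R^a$. Then $M^a_{\neg\ell osp}$ is empty (has no accepting execution) if and only if $$L\big((T^a_R)^*(A^a_{S_0})\cap F^a\cap\Pi_{\neq2}((T^a_R)^+\cap T_{id})\big)=\emptyset,$$ i.e. iff there is no word $w$ over $\Sigma^a$ reachable from $L(A^a_{S_0})$ by zero or more $R^a$-steps with $w\in L(F^a)$ and $(w,w)\in(R^a)^+$.
   Context: A regular system $M=(\Sigma,A_{S_0},T_R)$ consists of a finite alphabet $\Sigma$, a deterministic finite-word automaton $A_{S_0}$ over $\Sigma$ (initial states $L(A_{S_0})$) and a deterministic finite-word transducer $T_R=(Q_R,\Sigma\times\Sigma,q_{0R},\delta_R,F_R)$ representing the relation $R$ of equal-length pairs $(u,v)$ with $(u(0),v(0))\cdots(u(n-1),v(n-1))$ accepted. An execution of $M$ is an infinite sequence $\pi=w_0w_1\cdots$ with $w_0\in L(A_{S_0})$ and $(w_i,w_{i+1})\in R$ (all executions assumed infinite). A system is locally-finite if every execution from any reachable state visits only finitely many distinct states. Each local execution property $\ell ep_i\subseteq\Sigma^\omega$ is recognized by a complete Büchi automaton $A_{\ell ep_i}=(Q_{\ell ep_i},\Sigma,q_{0,\ell ep_i},\Delta_{\ell ep_i},F_{\ell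 ep_i})$, and $A_{\neg\ell ep_i}=(Q_{\neg\ell ep_i},\Sigma,q_{0,\neg\ell ep_i},\Delta_{\neg\ell ep_i},F_{\neg\ell ep_i})$ is a complete Büchi automaton for $\Sigma^\omega\setminus\ell ep_i$. A local-oriented system property is a set $\ell osp\subseteq(2^{LEP})^*$ recognized by a finite-word automaton. Construction: $\Sigma^a=\Sigma\times\prod_{i=1}^kQ_{\ell ep_i}\times\prod_{i=1}^kQ_{\neg\ell ep_i}\times2^{LEP}\times2^{LEP}\times\{reset,noreset\}$. $T^a_R$ has state set $Q_R$, initial state $q_{0R}$, accepting states $F_R$, and a transition from $q$ to $q'$ on $((a_1,p_1,\dots,p_k,\bar p_1,\dots,\bar p_k,L_1,G_1,\rho_1),(a_2,p_1',\dots,p_k',\bar p_1',\dots,\bar p_k',L_2,G_2,\rho_2))$ iff $q'\in\delta_R(q,(a_1,a_2))$; $p_i'\in\Delta_{\ell ep_i}(p_i,a_1)$ and $\bar p_i'\in\Delta_{\neg\ell ep_i}(\bar p_i,a_1)$ for all $i$; $L_1=L_2$; and if $G_1=LEP$ then either ($G_2=\emptyset$, $\rho_2=reset$) or ($G_2=G_1$, $\rho_2=noreset$), otherwise $G_2=G_1\cup\{\ell ep_i\in L_1\mid p_i\in F_{\ell ep_i}\}\cup\{\ell ep_i\notin L_1\mid\bar p_i\in F_{\neg\ell ep_i}\}$ and $\rho_2=noreset$. $R^a$ is the set of equal-length word pairs over $\Sigma^a$ accepted by $T^a_R$; $(R^a)^+$ is its transitive closure; $T_{id}$ is the identity transducer;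 $\Pi_{\neq2}$ of a set of pairs is the set of first components; $(T^a_R)^*(A^a_{S_0})$ is the set of words reachable from $L(A^a_{S_0})$ by zero or more $R^a$-steps. $L(A^a_{S_0})$ consists of the words whose $j$-th letter is $(w(j),q_{0,\ell ep_1},\dots,q_{0,\ell ep_k},q_{0,\neg\ell ep_1},\dots,q_{0,\neg\ell ep_k},L^{(j)},\emptyset,noreset)$ for $0\le j<n$, with $w(0)\cdots w(n-1)\in L(A_{S_0})$ and $L^{(0)}\cdots L^{(n-1)}\in(2^{LEP})^*\setminus\ell osp$. $L(F^a)$ is the set of words all of whose letters have last component $reset$. An execution of $M^a_{\neg\ell osp}$ is an infinite sequence $w^a_0w^a_1\cdots$ with $w^a_0\in L(A^a_{S_0})$ and $(w^a_i,w^a_{i+1})\in R^a$; it is accepting if infinitely many $w^a_i\in L(F^a)$; the system is empty if it has no accepting execution. -}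

module Defs where

open import Data.Nat using (ℕ; zero; suc; _≤_)
open import Data.Fin using (Fin; zero; suc)
open import Data.Fin.Subset using (Subset; _∈_; _∪_; ⊤; ⊥)
open import Data.Bool using (Bool; true; false; _∧_; not)
open import Data.Vec using (tabulate; lookup)
open import Data.List using (List; []; _∷_; map; length; zip; foldl)
open import Data.List.Relation.Unary.All using (All)
import Data.List.Membership.Propositional as LM
open import Data.Product using (Σ; ∃; ∃-syntax; _×_; _,_)
open import Data.Sum using (_⊎_)
open import Data.Unit using () renaming (⊤ to Unit; tt to unit)
open import Relation.Nullary using (¬_)
open import Relation.Binary.PropositionalEquality using (_≡_; _≢_)
open import Relation.Binary.Construct.Closure.ReflexiveTransitive using (Star)
open import Relation.Binary.Construct.Closure.Transitive using (TransClosure)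
open import Function using (_∘_)

-- Finite products  Π_{i<k} Fin (n i)  (tuples of automaton states),
-- represented by a recursive product so that ≡ is decidable.

Tuple : (k : ℕ) → (Fin k → ℕ) → Set
Tuple zero    n = Unit
Tuple (suc k) n = Fin (n zero) × Tuple k (n ∘ suc)

lookupT : ∀ {k} {n : Fin k → ℕ} → Tuple k n → (i : Fin k) → Fin (n i)
lookupT (p , ps) zero    = p
lookupT (p , ps) (suc i) = lookupT ps i

record DFA (A : Set) : Set where
  field
    n  : ℕ
    q0 : Fin n
    δ  : Fin n → A → Fin n
    F  : Subset n

  run : Fin n → List A → Fin n
  run = foldl δ

  Accepts : List A → Set
  Accepts w = run q0 w ∈ F

record NFA (A : Set) : Set where
  field
    n  : ℕ
    q0 : Fin n
    Δ  : Fin n → A → Subset n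
    F  : Subset n

  data Run : Fin n → List A → Set where
    done : ∀ {q} → q ∈ F → Run q []
    step : ∀ {q q' a w} → q' ∈ Δ q a → Run q' w → Run q (a ∷ w)

  Accepts : List A → Set
  Accepts w = Run q0 w

record Buchi (A : Set) : Set where
  field
    n  : ℕ
    q0 : Fin n
    Δ  : Fin n → A → Subset n
    F  : Subset n

  Complete : Set
  Complete = ∀ q a → ∃[ q' ] q' ∈ Δ q a

  Accepts : (ℕ → A) → Set
  Accepts x = Σ (ℕ → Fin n) λ r → (r 0 ≡ q0
                    × (∀ i → r (suc i) ∈ Δ (r i) (x i))
                    × (∀ i → ∃[ j ] (i ≤ j × r j ∈ F)))

record RegSys (s : ℕ) : Set where
  field
    AS0 : DFA (Fin s)
    TR  : DFA (Fin s × Fin s)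

  R : List (Fin s) → List (Fin s) → Set
  R u v = length u ≡ length v × DFA.Accepts TR (zip u v)

  Init : List (Fin s) → Set
  Init = DFA.Accepts AS0

  Reachable : List (Fin s) → Set
  Reachable w = ∃[ w0 ] (Init w0 × Star R w0 w)

  LocallyFinite : Set
  LocallyFinite = ∀ w → Reachable w → (π : ℕ → List (Fin s)) → π 0 ≡ w
    → (∀ i → R (π i) (π (suc i)))
    → ∃[ ws ] (∀ i → π i LM.∈ ws)

data Reset : Set where
  reset noreset : Reset

module Aug {s k : ℕ} (M : RegSys s)
           (A N : Fin k → Buchi (Fin s))   -- A_{lep_i}, A_{¬lep_i}
           (osp : NFA (Subset k))
           where

  open RegSys M

  nA nN : Fin k → ℕ
  nA i = Buchi.n (A i)
  nN i = Buchi.n (N i)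

  record Letter : Set where
    constructor mkLetter
    field
      sym : Fin s
      ps  : Tuple k nA
      nps : Tuple k nN
      L   : Subset k
      G   : Subset k
      ρ   : Reset
  open Letter public

  Gnext : Letter → Subset k
  Gnext x = G x
          ∪ tabulate (λ i → lookup (L x) i ∧ lookup (Buchi.F (A i)) (lookupT (ps x) i))
          ∪ tabulate (λ i → not (lookup (L x) i) ∧ lookup (Buchi.F (N i)) (lookupT (nps x) i))

  GCond : Letter → Letter → Set
  GCond x y =
      (G x ≡ ⊤ × ((G y ≡ ⊥ × ρ y ≡ reset) ⊎ (G y ≡ G x × ρ y ≡ noreset)))
    ⊎ (G x ≢ ⊤ × G y ≡ Gnext x × ρ y ≡ noreset)

  QR : Set
  QR = Fin (DFA.n (RegSys.TR M))

  Step : QR → Letter → Letter → QR → Set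
  Step q x y q' =
      q' ≡ DFA.δ (RegSys.TR M) q (sym x , sym y)
    × (∀ i → lookupT (ps y) i ∈ Buchi.Δ (A i) (lookupT (ps x) i) (sym x))
    × (∀ i → lookupT (nps y) i ∈ Buchi.Δ (N i) (lookupT (nps x) i) (sym x))
    × L x ≡ L y
    × GCond x y

  data AccA : QR → List Letter → List Letter → Set where
    nil  : ∀ {q} → q ∈ DFA.F (RegSys.TR M) → AccA q [] []
    cons : ∀ {q q' x y u v} → Step q x y q' → AccA q' u v → AccA q (x ∷ u) (y ∷ v)

  Ra : List Letter → List Letter → Set
  Ra = AccA (DFA.q0 (RegSys.TR M))

  InitLetter : Letter → Set
  InitLetter x = (∀ i → lookupT (ps x) i ≡ Buchi.q0 (A i))
               × (∀ i → lookupT (nps x) i ≡ Buchi.q0 (N i))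
               × G x ≡ ⊥
               × ρ x ≡ noreset

  InitA : List Letter → Set
  InitA w = All InitLetter w
          × Init (map sym w)
          × ¬ NFA.Accepts osp (map L w)

  Fa : List Letter → Set
  Fa w = All (λ x → ρ x ≡ reset) w

  Execution : (ℕ → List Letter) → Set
  Execution e = InitA (e 0) × (∀ i → Ra (e i) (e (suc i)))

  AcceptingExec : (ℕ → List Letter) → Set
  AcceptingExec e = ∀ i → ∃[ j ] (i ≤ j × Fa (e j))

  IsEmpty : Set
  IsEmpty = ¬ (∃[ e ] (Execution e × AcceptingExec e))

  ReachA : List Letter → Set
  ReachA w = ∃[ w0 ] (InitA w0 × Star Ra w0 w)

  NoLasso : Set
  NoLasso = ¬ (∃[ w ] (ReachA w × Fa w × TransClosure Ra w w))

module Submission where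

-- Both directions are instances of the classical characterisation of
-- Büchi emptiness for transition systems, proved here for an arbitrary
-- relation R:
--   * a lasso (a reachable accepting state w with w R⁺ w) unrolls into
--     an infinite path that visits the accepting state infinitely often;
--   * conversely, an infinite path that visits accepting states infinitely
--     often and stays inside a finite set visits some accepting state
--     twice (pigeonhole), which yields a lasso.
-- For M^a_{¬losp} the finiteness comes for free: R^a relates words of
-- equal length over the finite alphabet Σ^a, so every execution stays in
-- the finite set of words of the length of its initial word.

open import Defs
open import Data.Nat using (ℕ; zero; suc; _≤_; _<_; z≤n; s≤s)
open import Data.Nat.Properties using (n<1+n; m<1+n⇒m<n∨m≡n; <-trans; m≤n⇒m≤1+n)
open import Data.Fin using (Fin; toℕ)
import Data.Fin.Properties as Fin
import Data.Fin as Fin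
open import Data.Fin.Subset using (Subset)
open import Data.Bool using (Bool; true; false)
open import Data.Vec using (Vec; []; _∷_)
open import Data.List using (List; []; _∷_; map; length; lookup; allFin; cartesianProduct; cartesianProductWith)
open import Data.List.Membership.Propositional using (_∈_)
open import Data.List.Membership.Propositional.Properties using (∈-allFin; ∈-map⁺; ∈-cartesianProduct⁺; ∈-cartesianProductWith⁺)
open import Data.List.Relation.Unary.Any using (here; there; index)
open import Data.List.Relation.Unary.Any.Properties using (lookup-index)
open import Data.Product using (proj₁; ∃₂; ∃-syntax; _×_; _,_)
open import Data.Sum using (inj₁; inj₂)
open import Data.Unit using () renaming (⊤ to Unit; tt to unit)
open import Relation.Nullary using (¬_)
open import Relation.Binary.PropositionalEquality using (_≡_; refl; sym; trans; cong; subst; module ≡-Reasoning)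
open import Relation.Binary.Construct.Closure.ReflexiveTransitive using (Star; ε; _◅_; _◅◅_)
open import Relation.Binary.Construct.Closure.Transitive using (TransClosure; [_]; _∷_; _∷ʳ_)
open import Function.Bundles using (_⇔_; mk⇔)

record Finite (A : Set) : Set where
  field
    elements : List A
    complete : ∀ x → x ∈ elements
open Finite

Fin-finite : ∀ n → Finite (Fin n)
Fin-finite n = record { elements = allFin n ; complete = ∈-allFin }

Unit-finite : Finite Unit
Unit-finite = record { elements = unit ∷ [] ; complete = λ { unit → here refl } }

Bool-finite : Finite Bool
Bool-finite = record
  { elements = true ∷ false ∷ []
  ; complete = λ { true → here refl ; false → there (here refl) } }

Reset-finite : Finite Reset
Reset-finite = record
  { elements = reset ∷ noreset ∷ []
  ; complete = λ { reset → here refl ; noreset → there (here refl) } }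

×-finite : ∀ {A B} → Finite A → Finite B → Finite (A × B)
×-finite FA FB = record
  { elements = cartesianProduct (elements FA) (elements FB)
  ; complete = λ { (a , b) → ∈-cartesianProduct⁺ (complete FA a) (complete FB b) } }

image-finite : ∀ {A B} (f : B → A) (g : A → B) → (∀ a → f (g a) ≡ a) → Finite B → Finite A
image-finite f g fg FB = record
  { elements = map f (elements FB)
  ; complete = λ a → subst (_∈ map f (elements FB)) (fg a) (∈-map⁺ f (complete FB (g a))) }

Vec-finite : ∀ {A} → Finite A → ∀ k → Finite (Vec A k)
Vec-finite FA zero    = record { elements = [] ∷ [] ; complete = λ { [] → here refl } }
Vec-finite FA (suc k) =
  image-finite (λ { (x , xs) → x ∷ xs }) (λ { (x ∷ xs) → x , xs }) (λ { (x ∷ xs) → refl })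
               (×-finite FA (Vec-finite FA k))

Tuple-finite : ∀ k (n : Fin k → ℕ) → Finite (Tuple k n)
Tuple-finite zero    n = Unit-finite
Tuple-finite (suc k) n = ×-finite (Fin-finite (n Fin.zero)) (Tuple-finite k (λ i → n (Fin.suc i)))

words : ∀ {A} → Finite A → ℕ → List (List A)
words FA zero    = [] ∷ []
words FA (suc n) = cartesianProductWith _∷_ (elements FA) (words FA n)

words-complete : ∀ {A} (FA : Finite A) (w : List A) → w ∈ words FA (length w)
words-complete FA []      = here refl
words-complete FA (x ∷ w) = ∈-cartesianProductWith⁺ _∷_ (complete FA x) (words-complete FA w)

pigeonhole : ∀ {A : Set} (xs : List A) (f : ℕ → A) → (∀ i → f i ∈ xs) →
             ∃₂ λ i j → i < j × f i ≡ f j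
pigeonhole xs f f∈xs = repeated (Fin.pigeonhole (n<1+n (length xs)) slot)
  where
  open ≡-Reasoning
  slot : Fin (suc (length xs)) → Fin (length xs)
  slot i = index (f∈xs (toℕ i))
  repeated : (∃₂ λ i j → i Fin.< j × slot i ≡ slot j) → ∃₂ λ i j → i < j × f i ≡ f j
  repeated (i , j , i<j , same-slot) = toℕ i , toℕ j , i<j , (begin
    f (toℕ i)          ≡⟨ lookup-index (f∈xs (toℕ i)) ⟩
    lookup xs (slot i) ≡⟨ cong (lookup xs) same-slot ⟩
    lookup xs (slot j) ≡⟨ sym (lookup-index (f∈xs (toℕ j))) ⟩
    f (toℕ j)          ∎)

increasing-mono : (t : ℕ → ℕ) → (∀ m → t m < t (suc m)) → ∀ {a b} → a < b → t a < t b
increasing-mono t inc {b = suc b} a<1+b with m<1+n⇒m<n∨m≡n a<1+b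
... | inj₁ a<b  = <-trans (increasing-mono t inc a<b) (inc b)
... | inj₂ refl = inc b

module Paths {A : Set} (R : A → A → Set) where

  Path : (ℕ → A) → Set
  Path e = ∀ i → R (e i) (e (suc i))

  Recurrent : (A → Set) → (ℕ → A) → Set
  Recurrent P e = ∀ i → ∃[ j ] (i ≤ j × P (e j))

  path-star : ∀ {e} → Path e → ∀ n → Star R (e 0) (e n)
  path-star p zero    = ε
  path-star p (suc n) = path-star p n ◅◅ (p n ◅ ε)

  path-plus : ∀ {e} → Path e → ∀ {a b} → a < b → TransClosure R (e a) (e b)
  path-plus p {b = suc b} a<1+b with m<1+n⇒m<n∨m≡n a<1+b
  ... | inj₁ a<b  = path-plus p a<b ∷ʳ p b
  ... | inj₂ refl = [ p b ]

  recurrent-positions : ∀ {P e} → Recurrent P e →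
                        ∃[ t ] ((∀ m → t m < t (suc m)) × (∀ m → P (e (t m))))
  recurrent-positions {P} {e} rec = t , t-increasing , t-visits
    where
    t : ℕ → ℕ
    t zero    = proj₁ (rec 0)
    t (suc m) = proj₁ (rec (suc (t m)))
    t-increasing : ∀ m → t m < t (suc m)
    t-increasing m with rec (suc (t m))
    ... | _ , later , _ = later
    t-visits : ∀ m → P (e (t m))
    t-visits zero    with rec 0
    ... | _ , _ , visit = visit
    t-visits (suc m) with rec (suc (t m))
    ... | _ , _ , visit = visit

  run⇒lasso : ∀ {P e} (xs : List A) → Path e → Recurrent P e → (∀ i → e i ∈ xs) →
              ∃[ w ] (Star R (e 0) w × P w × TransClosure R w w)
  run⇒lasso {P} {e} xs p rec e∈xs
    with t , t-increasing , t-visits ← recurrent-positions {P} {e} rec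
    with i , j , i<j , same ← pigeonhole xs (λ m → e (t m)) (λ m → e∈xs (t m))
    = e (t i) , path-star p (t i) , t-visits i , cycle
    where
    cycle : TransClosure R (e (t i)) (e (t i))
    cycle = subst (TransClosure R (e (t i))) (sym same)
                  (path-plus p (increasing-mono t t-increasing i<j))

  module Around {w : A} (c : TransClosure R w w) where

    around : ∀ {x} → TransClosure R x w → ℕ → A
    around {x} q zero    = x
    around [ _ ]   (suc n) = around c n
    around (_ ∷ q) (suc n) = around q n

    around-path : ∀ {x} (q : TransClosure R x w) → Path (around q)
    around-path [ r ]   zero    = r
    around-path (r ∷ q) zero    = r
    around-path [ _ ]   (suc i) = around-path c i
    around-path (_ ∷ q) (suc i) = around-path q i

    around-returns : ∀ {x} (q : TransClosure R x w) → Recurrent (_≡ w) (around q)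
    around-returns [ _ ] zero = 1 , z≤n , refl
    around-returns (_ ∷ q) zero with around-returns q zero
    ... | j , _ , returns = suc j , z≤n , returns
    around-returns [ _ ] (suc i) with around-returns c i
    ... | j , i≤j , returns = suc j , s≤s i≤j , returns
    around-returns (_ ∷ q) (suc i) with around-returns q i
    ... | j , i≤j , returns = suc j , s≤s i≤j , returns

    lasso-run : ∀ {x} → Star R x w → ℕ → A
    lasso-run ε         n       = around c n
    lasso-run {x} (_ ◅ s) zero  = x
    lasso-run (_ ◅ s)   (suc n) = lasso-run s n

    lasso-run-start : ∀ {x} (s : Star R x w) → lasso-run s 0 ≡ x
    lasso-run-start ε       = refl
    lasso-run-start (_ ◅ s) = refl

    lasso-run-path : ∀ {x} (s : Star R x w) → Path (lasso-run s)
    lasso-run-path ε       i       = around-path c i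
    lasso-run-path (r ◅ s) zero    = subst (R _) (sym (lasso-run-start s)) r
    lasso-run-path (_ ◅ s) (suc i) = lasso-run-path s i

    lasso-run-returns : ∀ {x} (s : Star R x w) → Recurrent (_≡ w) (lasso-run s)
    lasso-run-returns ε       i = around-returns c i
    lasso-run-returns (_ ◅ s) i with lasso-run-returns s i
    ... | j , i≤j , returns = suc j , m≤n⇒m≤1+n i≤j , returns

  lasso⇒run : ∀ {P x w} → Star R x w → P w → TransClosure R w w →
              ∃[ e ] (e 0 ≡ x × Path e × Recurrent P e)
  lasso⇒run {P} s pw c =
    lasso-run s , lasso-run-start s , lasso-run-path s , visits
    where
    open Around c
    visits : Recurrent P (lasso-run s)
    visits i with lasso-run-returns s i
    ... | j , i≤j , returns = j , i≤j , subst P (sym returns) pw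

module Augmented {s k : ℕ} (M : RegSys s) (A N : Fin k → Buchi (Fin s)) (osp : NFA (Subset k)) where
  open Aug M A N osp hiding (sym)
  open Paths Ra

  Letter-finite : Finite Letter
  Letter-finite =
    image-finite (λ { (a , p , p̄ , l , g , r) → mkLetter a p p̄ l g r })
                 (λ x → Aug.Letter.sym x , ps x , nps x , L x , G x , ρ x)
                 (λ x → refl)
                 (×-finite (Fin-finite s) (×-finite (Tuple-finite k nA) (×-finite (Tuple-finite k nN)
                   (×-finite (Vec-finite Bool-finite k) (×-finite (Vec-finite Bool-finite k) Reset-finite)))))

  accepted-length : ∀ {q u v} → AccA q u v → length u ≡ length v
  accepted-length (nil _)    = refl
  accepted-length (cons _ a) = cong suc (accepted-length a)

  path-bounded : ∀ {e} → Path e → ∀ i → e i ∈ words Letter-finite (length (e 0))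
  path-bounded {e} p i = subst (λ n → e i ∈ words Letter-finite n) (same-length i) (words-complete Letter-finite (e i))
    where
    same-length : ∀ i → length (e i) ≡ length (e 0)
    same-length zero    = refl
    same-length (suc i) = trans (sym (accepted-length (p i))) (same-length i)

proposition31 : {s k : ℕ} (M : RegSys s) (A N : Fin k → Buchi (Fin s)) (osp : NFA (Subset k))
    → RegSys.LocallyFinite M
    → (∀ i → Buchi.Complete (A i))
    → (∀ i → Buchi.Complete (N i))
    → (∀ i (x : ℕ → Fin s) → Buchi.Accepts (N i) x ⇔ (¬ Buchi.Accepts (A i) x))
    → Aug.IsEmpty M A N osp ⇔ Aug.NoLasso M A N osp
proposition31 M A N osp _ _ _ _ = mk⇔ empty⇒noLasso noLasso⇒empty
  where
  open Aug M A N osp hiding (sym)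
  open Paths Ra
  open Augmented M A N osp

  empty⇒noLasso : IsEmpty → NoLasso
  empty⇒noLasso empty (w , (w0 , init , reach) , accepting , cycle)
    with e , start , path , recurrent ← lasso⇒run reach accepting cycle
    = empty (e , (subst InitA (sym start) init , path) , recurrent)

  noLasso⇒empty : NoLasso → IsEmpty
  noLasso⇒empty noLasso (e , (init , path) , recurrent)
    with w , reach , accepting , cycle ← run⇒lasso _ path recurrent (path-bounded path)
    = noLasso (w , (e 0 , init , reach) , accepting , cycle)
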